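{- For every unimodal formula $\phi$, every $i\in\{1,\ldots,n_\phi\}$ and every $(a_1,\ldots,a_{n_\phi})\in W_\phi^{k_\phi}$: $(W_\phi^{k_\phi},R_\phi^{k_\phi},V_\phi^{k_\phi}),(a_1,\ldots,a_{n_\phi})\models\psi_i$ if and only if $a_i=1$.
   Context: Unimodal formulas are built from atoms, $\bot$, $\neg$, $\vee$ and $\square$. Fix a formula $\phi$; let $\Sigma_\phi$ be its set of subformulas, $n_\phi=|\Sigma_\phi|$, and $(\psi_1,\ldots,\psi_{n_\phi})$ an enumeration of $\Sigma_\phi$ such that if $\psi_i=\neg\psi_j$ or $\psi_i=\square\psi_j$ then $i>j$, and if $\psi_i=\psi_j\vee\psi_k$ then $i>j,k$. A $\phi$-tip is a tuple $(a_1,\ldots,a_{n_\phi})\in\{0,1\}^{n_\phi}$ such that $a_i=0$ if $\psi_i=\bot$, $a_i=1-a_j$ if $\psi_i=\neg\psi_j$, $a_i=\max\{a_j,a_k\}$ if $\psi_i=\psi_j\vee\psi_k$. $W_\phi^0$ is the set of all $\phi$-tips and $R_\phi^0$ relates $a$ to $b$ iff for all $i,j$, if $\psi_i=\square\psi_j$ and $a_i=1$ then $b_j=1$. For a structure $(W,R)$ with $W\subseteq W_\phi^0$, $\sigma_\phi(W,R)=(W',R')$ where $W'$ is the set of $a\in W$ such that for all $i,j$ with $\psi_i=\square\psi_j$ and $a_i=0$ there is $b\in W$ with $aRb$ and $b_j=0$; and for $a,b\in W'$, $aR'b$ iff $aRb$ and there is $c\in W$ with $aRc$ and $cRb$. $k_\phi$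 is the least $k$ with $\sigma_\phi^{k+1}(W_\phi^0,R_\phi^0)=\sigma_\phi^k(W_\phi^0,R_\phi^0)$, and $(W_\phi^{k_\phi},R_\phi^{k_\phi})=\sigma_\phi^{k_\phi}(W_\phi^0,R_\phi^0)$. $V_\phi^{k_\phi}$ is a valuation on this frame such that for every atom $p$ and every $i$ with $\psi_i=p$, $V_\phi^{k_\phi}(p)=\{a\in W_\phi^{k_\phi}: a_i=1\}$. -}

module Defs where

open import Data.Nat using (ℕ; zero; suc; _<_)
open import Data.Fin using (Fin)
open import Data.Bool using (Bool; true; false; not; _∨_)
open import Data.Product using (Σ; ∃; _×_; _,_)
open import Data.Sum using (_⊎_)
open import Data.Empty using (⊥)
open import Relation.Binary.PropositionalEquality using (_≡_)
open import Function.Bundles using (_⇔_)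
open import Function.Definitions using (Injective)
open import Relation.Nullary using (¬_)

data Form : Set where
  atom : ℕ → Form
  bot  : Form
  neg  : Form → Form
  _or_ : Form → Form → Form
  box  : Form → Form

data _≼_ : Form → Form → Set where
  here  : ∀ {φ} → φ ≼ φ
  neg≼  : ∀ {ψ φ} → ψ ≼ φ → ψ ≼ neg φ
  orˡ≼  : ∀ {ψ φ χ} → ψ ≼ φ → ψ ≼ (φ or χ)
  orʳ≼  : ∀ {ψ φ χ} → ψ ≼ χ → ψ ≼ (φ or χ)
  box≼  : ∀ {ψ φ} → ψ ≼ φ → ψ ≼ box φ

-- An admissible enumeration (ψ₁,…,ψₙ) of the subformulas Σ_φ of φ, with n = n_φ.
record Enumeration (φ : Form) (n : ℕ) : Set where
  field
    ψ        : Fin n → Form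
    injective : Injective _≡_ _≡_ ψ
    sound    : ∀ i → ψ i ≼ φ
    complete : ∀ χ → χ ≼ φ → ∃ λ i → ψ i ≡ χ
    ord-neg  : ∀ i j → ψ i ≡ neg (ψ j) → j Data.Fin.< i
    ord-box  : ∀ i j → ψ i ≡ box (ψ j) → j Data.Fin.< i
    ord-or   : ∀ i j k → ψ i ≡ (ψ j or ψ k) → (j Data.Fin.< i) × (k Data.Fin.< i)

-- tuples (a₁,…,aₙ) ∈ {0,1}ⁿ, with 1 = true and 0 = false
Tuple : ℕ → Set
Tuple n = Fin n → Bool

record Struct (n : ℕ) : Set₁ where
  constructor ⟨_,_⟩
  field
    W : Tuple n → Set
    R : Tuple n → Tuple n → Set

_≈S_ : ∀ {n} → Struct n → Struct n → Set
_≈S_ {n} ⟨ W , R ⟩ ⟨ W' , R' ⟩ =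
  (∀ a → W a ⇔ W' a) × (∀ a b → W a → W b → R a b ⇔ R' a b)

module _ {φ : Form} {n : ℕ} (E : Enumeration φ n) where
  open Enumeration E

  IsTip : Tuple n → Set
  IsTip a =
      (∀ i → ψ i ≡ bot → a i ≡ false)
    × (∀ i j → ψ i ≡ neg (ψ j) → a i ≡ not (a j))
    × (∀ i j k → ψ i ≡ (ψ j or ψ k) → a i ≡ (a j ∨ a k))

  R⁰ : Tuple n → Tuple n → Set
  R⁰ a b = ∀ i j → ψ i ≡ box (ψ j) → a i ≡ true → b j ≡ true

  S⁰ : Struct n
  S⁰ = ⟨ IsTip , R⁰ ⟩

  σ : Struct n → Struct n
  σ ⟨ W , R ⟩ = ⟨ W' , R' ⟩
    where
      W' : Tuple n → Set
      W' a = W a × (∀ i j → ψ i ≡ box (ψ j) → a i ≡ false →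
                      ∃ λ b → W b × R a b × (b j ≡ false))
      R' : Tuple n → Tuple n → Set
      R' a b = R a b × (∃ λ c → W c × R a c × R c b)

  σ^ : ℕ → Struct n
  σ^ zero    = S⁰
  σ^ (suc k) = σ (σ^ k)

  IsKφ : ℕ → Set
  IsKφ k = (σ^ (suc k) ≈S σ^ k) × (∀ k' → k' < k → ¬ (σ^ (suc k') ≈S σ^ k'))

_,_,_⊨_ : ∀ {n} → Struct n → (ℕ → Tuple n → Set) → Tuple n → Form → Set
S , V , a ⊨ atom p   = V p a
S , V , a ⊨ bot      = ⊥
S , V , a ⊨ neg χ    = ¬ (S , V , a ⊨ χ)
S , V , a ⊨ (χ or θ) = (S , V , a ⊨ χ) ⊎ (S , V , a ⊨ θ)
S , V , a ⊨ box χ    = ∀ b → Struct.W S b → Struct.R S a b → S , V , b ⊨ χ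

-- V is a valuation on (W,R) as required of V_φ^{k_φ}:
-- for every atom p and i with ψ_i = p, V(p) = {a ∈ W : a_i = 1}
IsVφ : ∀ {φ n} → Enumeration φ n → Struct n → (ℕ → Tuple n → Set) → Set
IsVφ {n = n} E S V = ∀ p (i : Fin n) → Enumeration.ψ E i ≡ atom p →
  ∀ a → Struct.W S a → (V p a ⇔ (a i ≡ true))

-- Worlds of W_φ^{k_φ} are φ-tips, so the truth lemma is immediate for the Boolean
-- connectives.  For □ψ_j, the direction a_i = 1 ⇒ a ⊨ □ψ_j holds because every edge of
-- R_φ^{k_φ} is an edge of R_φ^0.  Conversely, at the fixed point σ_φ does not remove a,
-- so if a_i = 0 then a has a successor b in W_φ^{k_φ} with b_j = 0, i.e. b ⊭ ψ_j.
module Submission where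

open import Defs
open import Data.Nat using (ℕ; zero; suc)
open import Data.Fin using (Fin)
open import Data.Bool using (true; false; not; _∨_)
open import Data.Bool.Properties using (not-¬; ¬-not)
open import Data.Product using (_,_; proj₂)
open import Data.Sum using (_⊎_; inj₁; inj₂)
open import Data.Sum.Function.Propositional using (_⊎-⇔_)
open import Data.Empty using (⊥; ⊥-elim)
open import Relation.Nullary using (¬_)
open import Relation.Binary.PropositionalEquality using (_≡_; refl)
open import Function.Bundles using (_⇔_; mk⇔; Equivalence)
open import Function.Properties.Equivalence using () renaming (trans to ⇔-trans; sym to ⇔-sym)
open import Function.Related.TypeIsomorphisms using (¬-cong-⇔)

≼-trans : ∀ {χ θ φ} → χ ≼ θ → θ ≼ φ → χ ≼ φ
≼-trans p here     = p
≼-trans p (neg≼ q) = neg≼ (≼-trans p q)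
≼-trans p (orˡ≼ q) = orˡ≼ (≼-trans p q)
≼-trans p (orʳ≼ q) = orʳ≼ (≼-trans p q)
≼-trans p (box≼ q) = box≼ (≼-trans p q)

not-≡-true : ∀ {x} → (not x ≡ true) ⇔ (¬ (x ≡ true))
not-≡-true {true}  = mk⇔ (λ ()) (λ ¬t → ⊥-elim (¬t refl))
not-≡-true {false} = mk⇔ (λ _ ()) (λ _ → refl)

∨-≡-true : ∀ {x y} → (x ∨ y ≡ true) ⇔ (x ≡ true ⊎ y ≡ true)
∨-≡-true {true}          = mk⇔ inj₁ (λ _ → refl)
∨-≡-true {false} {true}  = mk⇔ inj₂ (λ _ → refl)
∨-≡-true {false} {false} = mk⇔ inj₁ λ { (inj₁ ()) ; (inj₂ ()) }

bot-reflects : ∀ {x} → x ≡ false → ⊥ ⇔ (x ≡ true)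
bot-reflects refl = mk⇔ ⊥-elim (λ ())

neg-reflects : ∀ {p} {P : Set p} {x y} → x ≡ not y → P ⇔ (y ≡ true) → (¬ P) ⇔ (x ≡ true)
neg-reflects refl P⇔y = ⇔-trans (¬-cong-⇔ P⇔y) (⇔-sym not-≡-true)

or-reflects : ∀ {p q} {P : Set p} {Q : Set q} {x y z} → x ≡ y ∨ z →
              P ⇔ (y ≡ true) → Q ⇔ (z ≡ true) → (P ⊎ Q) ⇔ (x ≡ true)
or-reflects refl P⇔y Q⇔z = ⇔-trans (P⇔y ⊎-⇔ Q⇔z) (⇔-sym ∨-≡-true)

module _ {φ : Form} {n : ℕ} (E : Enumeration φ n) where
  open Enumeration E

  tip-bot : ∀ {a i} → IsTip E a → ψ i ≡ bot → a i ≡ false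
  tip-bot (bot-false , _ , _) e = bot-false _ e

  tip-neg : ∀ {a i j χ} → IsTip E a → ψ i ≡ neg χ → ψ j ≡ χ → a i ≡ not (a j)
  tip-neg (_ , neg-not , _) e refl = neg-not _ _ e

  tip-or : ∀ {a i j l χ θ} → IsTip E a → ψ i ≡ (χ or θ) → ψ j ≡ χ → ψ l ≡ θ →
           a i ≡ a j ∨ a l
  tip-or (_ , _ , or-∨) e refl refl = or-∨ _ _ _ e

  σ^-worlds-are-tips : ∀ k {a} → Struct.W (σ^ E k) a → IsTip E a
  σ^-worlds-are-tips zero    w       = w
  σ^-worlds-are-tips (suc k) (w , _) = σ^-worlds-are-tips k w

  σ^-edges-in-R⁰ : ∀ k {a b} → Struct.R (σ^ E k) a b → R⁰ E a b
  σ^-edges-in-R⁰ zero    r       = r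
  σ^-edges-in-R⁰ (suc k) (r , _) = σ^-edges-in-R⁰ k r

  σ-Stable : Struct n → Set
  σ-Stable S = ∀ {a} → Struct.W S a → Struct.W (σ E S) a

  fixpoint-σ-stable : ∀ {S} → σ E S ≈S S → σ-Stable S
  fixpoint-σ-stable (W⇔ , _) {a} = Equivalence.from (W⇔ a)

  module TruthLemma (S : Struct n) (V : ℕ → Tuple n → Set) (atoms : IsVφ E S V)
                    (tips : ∀ {a} → Struct.W S a → IsTip E a)
                    (edges : ∀ {a b} → Struct.R S a b → R⁰ E a b)
                    (stable : σ-Stable S) where
    open Struct S

    box-reflects : ∀ {a i j χ} (P : Tuple n → Set) → ψ i ≡ box χ → ψ j ≡ χ →
                   (∀ {b} → W b → P b ⇔ (b j ≡ true)) → W a →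
                   (∀ b → W b → R a b → P b) ⇔ (a i ≡ true)
    box-reflects {a} {i} {j} P e refl IH w = mk⇔ forced supported
      where
        forced : (∀ b → W b → R a b → P b) → a i ≡ true
        forced □P = ¬-not λ aᵢ≡false →
          let b , wb , ab , bⱼ≡false = proj₂ (stable w) i j e aᵢ≡false
          in not-¬ (Equivalence.to (IH wb) (□P b wb ab)) bⱼ≡false

        supported : a i ≡ true → ∀ b → W b → R a b → P b
        supported aᵢ≡true b wb ab = Equivalence.from (IH wb) (edges ab i j e aᵢ≡true)

    truth : ∀ χ → χ ≼ φ → ∀ {i} → ψ i ≡ χ → ∀ {a} → W a → (S , V , a ⊨ χ) ⇔ (a i ≡ true)
    truth (atom p) _ e w = atoms p _ e _ w
    truth bot      _ e w = bot-reflects (tip-bot (tips w) e)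
    truth (neg χ) s e w =
      let sχ = ≼-trans (neg≼ here) s ; j , eⱼ = complete χ sχ
      in neg-reflects (tip-neg (tips w) e eⱼ) (truth χ sχ eⱼ w)
    truth (χ or θ) s e w =
      let sχ = ≼-trans (orˡ≼ here) s ; j , eⱼ = complete χ sχ
          sθ = ≼-trans (orʳ≼ here) s ; l , eₗ = complete θ sθ
      in or-reflects (tip-or (tips w) e eⱼ eₗ) (truth χ sχ eⱼ w) (truth θ sθ eₗ w)
    truth (box χ) s e w =
      let sχ = ≼-trans (box≼ here) s ; j , eⱼ = complete χ sχ
      in box-reflects (λ b → S , V , b ⊨ χ) e eⱼ (truth χ sχ eⱼ) w

lemma9 : (φ : Form) (n : ℕ) (E : Enumeration φ n) (k : ℕ) → IsKφ E k →
    (V : ℕ → Tuple n → Set) → IsVφ E (σ^ E k) V →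
    (i : Fin n) (a : Tuple n) → Struct.W (σ^ E k) a →
    ((σ^ E k) , V , a ⊨ Enumeration.ψ E i) ⇔ (a i ≡ true)
lemma9 φ n E k (fixpoint , _) V atoms i a w =
  TruthLemma.truth E (σ^ E k) V atoms
    (σ^-worlds-are-tips E k) (σ^-edges-in-R⁰ E k) (fixpoint-σ-stable E fixpoint)
    (Enumeration.ψ E i) (Enumeration.sound E i) refl w
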